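{- Let $p$ be an odd prime and let $n,s$ be positive integers such that $2n/s \geq 3$ is an odd integer; put $q = p^n$, $d = p^s$, and let $\mathbb{F}_q \subset \mathbb{F}_{q^2}$ be the subfield of order $q$. Fix $\mu \in \mathbb{F}_{q^2} \setminus \mathbb{F}_q$ such that $\mu^d = u_1 + u_2\mu$ with $u_1,u_2 \in \mathbb{F}_q$ and $u_2$ a $(d-1)$-th power in $\mathbb{F}_{q^2}$. Partition $\mathbb{F}_q \setminus\{0\} = \mathbb{F}_q^+ \cup \mathbb{F}_q^-$ so that $a \in \mathbb{F}_q^+$ iff $-a \in \mathbb{F}_q^-$. Then the set \[ I^+ = \{(a^d + a, x_1 + x_2\mu) : a, x_1 \in \mathbb{F}_q,\ x_2 \in \mathbb{F}_q^+\} \] is an independent set in the graph $\mathcal{A}_{q^2,d}$, and the same holds for the set $I^-$ defined with $\mathbb{F}_q^-$ in place of $\mathbb{F}_q^+$.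
   Context: The map $x \mapsto x^d + x$ is a bijection of $\mathbb{F}_{q^2}$. $\mathcal{A}_{q^2,d}$ is the graph with vertex set $\mathbb{F}_{q^2} \times \mathbb{F}_{q^2}$ in which distinct vertices $(a^d + a, x)$ and $(b^d + b, y)$ ($a,b,x,y \in \mathbb{F}_{q^2}$) are adjacent iff $a^d b + a b^d = x + y$. -}

module Defs where

open import Level using (Level; _⊔_)
open import Algebra.Bundles using (CommutativeRing)
open import Data.Nat as ℕ using (ℕ; zero; suc)
open import Data.Fin using (Fin)
open import Data.Product using (Σ; ∃; _×_; _,_)
open import Data.Sum using (_⊎_)
open import Relation.Nullary using (¬_)
open import Function.Bundles using (Inverse)
import Relation.Binary.PropositionalEquality as ≡

OddNat : ℕ → Set
OddNat k = ∃ λ j → k ≡.≡ suc (2 ℕ.* j)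

module FF {c ℓ : Level} (R : CommutativeRing c ℓ) where
  open CommutativeRing R

  IsField : Set (c ⊔ ℓ)
  IsField = (¬ (0# ≈ 1#)) × (∀ x → ¬ (x ≈ 0#) → ∃ λ y → (x * y) ≈ 1#)

  HasOrder : ℕ → Set (c ⊔ ℓ)
  HasOrder m = Inverse (≡.setoid (Fin m)) setoid

  pow : Carrier → ℕ → Carrier
  pow x zero = 1#
  pow x (suc k) = x * pow x k

  -- membership in the subfield of order q: { x | x^q = x }
  InSub : ℕ → Carrier → Set ℓ
  InSub q x = pow x q ≈ x

  -- Plus is "F_q^+": together with F_q^- = { a | -a ∈ F_q^+ } it partitions F_q \ {0}.
  SignPartition : ℕ → (Carrier → Set ℓ) → Set (c ⊔ ℓ)
  SignPartition q Plus =
    (∀ a b → a ≈ b → Plus a → Plus b) ×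
    (∀ a → Plus a → InSub q a × ¬ (a ≈ 0#)) ×
    (∀ a → InSub q a → ¬ (a ≈ 0#) → Plus a ⊎ Plus (- a)) ×
    (∀ a → ¬ (Plus a × Plus (- a)))

  Vertex : Set c
  Vertex = Carrier × Carrier

  _≈V_ : Vertex → Vertex → Set ℓ
  (u₁ , u₂) ≈V (v₁ , v₂) = (u₁ ≈ v₁) × (u₂ ≈ v₂)

  Adj : ℕ → Vertex → Vertex → Set (c ⊔ ℓ)
  Adj d u v = ¬ (u ≈V v) × (∃ λ a → ∃ λ b → ∃ λ x → ∃ λ y →
      (u ≈V ((pow a d + a) , x)) × (v ≈V ((pow b d + b) , y)) ×
      ((pow a d * b + a * pow b d) ≈ (x + y)))

  IndependentSet : ℕ → (Vertex → Set (c ⊔ ℓ)) → Set (c ⊔ ℓ)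
  IndependentSet d S = ∀ u v → S u → S v → ¬ (Adj d u v)

  ISet : ℕ → ℕ → Carrier → (Carrier → Set ℓ) → Vertex → Set (c ⊔ ℓ)
  ISet q d μ S v = ∃ λ a → ∃ λ x₁ → ∃ λ x₂ →
      InSub q a × InSub q x₁ × S x₂ × (v ≈V ((pow a d + a) , (x₁ + x₂ * μ)))

module Submission where

-- Let R be the field of order q² = p^(2n), d = p^s and F_q = { x | x^q = x }.
-- Suppose (A^d + A, x₁ + x₂μ) and (B^d + B, y₁ + y₂μ) in I^S are adjacent,
-- the edge being witnessed by a, b with a^d b + a b^d = x + y.  As the
-- labelling a ↦ a^d + a is injective, a = A and b = B lie in F_q, hence so
-- does a^d b + a b^d = (x₁ + y₁) + (x₂ + y₂)μ.  Here x₂ + y₂ ≠ 0, since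
-- otherwise x₂ and -x₂ would both lie in S; so μ ∈ F_q, a contradiction.

open import Defs
open import Level using (Level; _⊔_)
open import Algebra.Bundles using (CommutativeRing; CommutativeMonoid)
import Data.Nat as ℕ
open ℕ using (ℕ; zero; suc; z<s; s<s)
import Data.Nat.Properties as ℕ
open import Data.Nat.Divisibility using (_∣_; divides)
open import Data.Nat.Primality using (Prime; prime⇒nonZero)
open import Data.Nat.Combinatorics using (_C_; nCn≡1)
open import Data.Fin using (Fin; zero; suc; fromℕ; inject₁; punchIn)
open import Data.Fin.Properties using (toℕ-fromℕ; inject₁ℕ<; punchInᵢ≢i)
open import Data.Fin.Permutation using (Permutation′; permutation)
open import Data.Vec.Functional using (tail; init; removeAt)
open import Data.Product using (∃; _,_; proj₁; proj₂) renaming (_×_ to _∧_)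
open import Data.Empty using (⊥-elim)
open import Data.Maybe using (nothing)
open import Function.Base using (id; _∘_)
open import Function.Bundles using (Inverse)
open import Function.Definitions using (Congruent)
open import Relation.Nullary using (¬_; Dec; yes; no)
import Relation.Binary.PropositionalEquality as ≡

module PrimeArithmetic where
  open import Data.Nat
  open import Data.Nat.Properties
  open import Data.Nat.Divisibility
  open import Data.Nat.DivMod
  open import Data.Nat.Primality
  open import Data.Nat.Combinatorics
  open import Data.Sum using (inj₁; inj₂; [_,_])
  open import Relation.Binary.PropositionalEquality hiding ([_])

  prime⇒2+ : ∀ {p} → Prime p → ∃ λ r → p ≡ 2 + r
  prime⇒2+ {suc (suc r)} _ = r , refl
  prime⇒2+ {0} pp = ⊥-elim (¬prime[0] pp)
  prime⇒2+ {1} pp = ⊥-elim (¬prime[1] pp)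

  prime∤factorial : ∀ {p} → Prime p → ∀ j → j < p → ¬ (p ∣ j !)
  prime∤factorial pp zero _ p∣1 = ¬prime[1] (subst Prime (∣1⇒≡1 p∣1) pp)
  prime∤factorial pp (suc j) j<p p∣j! with euclidsLemma (suc j) (j !) pp p∣j!
  ... | inj₁ p∣1+j = <⇒≱ j<p (∣⇒≤ p∣1+j)
  ... | inj₂ p∣j!′ = prime∤factorial pp j (<-trans (n<1+n j) j<p) p∣j!′

  -- p divides the binomial coefficient p C k for 0 < k < p: it divides
  -- p! = (p C k) · k! · (p - k)! but neither factorial.
  prime∣binomial : ∀ {p k} → Prime p → 0 < k → k < p → p ∣ p C k
  prime∣binomial {p} {k} pp 0<k k<p with prime⇒2+ pp
  ... | r , refl = [ id , ⊥-elim ∘ p∤D ] (euclidsLemma (p C k) D pp p∣[pCk]*D)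
    where
      k≤p : k ≤ p
      k≤p = <⇒≤ k<p
      D : ℕ
      D = k ! * (p ∸ k) !
      instance
        D≢0 : NonZero D
        D≢0 = k !* (p ∸ k) !≢0
      p∣[pCk]*D : p ∣ (p C k) * D
      p∣[pCk]*D = subst (p ∣_)
        (sym (trans (cong (_* D) (nCk≡n!/k![n-k]! k≤p)) (m/n*n≡m (k![n∸k]!∣n! k≤p))))
        (m∣m*n ((suc r) !))
      p∤D : ¬ (p ∣ D)
      p∤D p∣D = [ prime∤factorial pp k k<p , prime∤factorial pp (p ∸ k) (∸-monoʳ-< 0<k k≤p) ]
                  (euclidsLemma (k !) ((p ∸ k) !) pp p∣D)

  odd-prime : ∀ {p} → Prime p → ¬ (p ≡ 2) → ∃ λ j → p ≡ 1 + 2 * j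
  odd-prime {p} pp p≢2 with p % 2 | m≡m%n+[m/n]*n p 2 | m%n<n p 2
  ... | 0 | p≡[p/2]*2 | _ with prime⇒irreducible pp (divides (p / 2) p≡[p/2]*2)
  ...   | inj₁ ()
  ...   | inj₂ 2≡p = ⊥-elim (p≢2 (sym 2≡p))
  odd-prime {p} pp p≢2 | 1 | p≡1+[p/2]*2 | _ =
    p / 2 , trans p≡1+[p/2]*2 (cong suc (*-comm (p / 2) 2))
  odd-prime {p} pp p≢2 | suc (suc _) | _ | s≤s (s≤s ())

module PowerMaps {c ℓ : Level} (R : CommutativeRing c ℓ) where
  open CommutativeRing R hiding (zero)
  open FF R using (pow)
  open import Algebra.Properties.Ring ring using (+-inverseʳ-unique)
  open import Algebra.Properties.Semiring.Mult semiring using (_×_; ×-congʳ; ×-assoc-*; ×1-homo-*)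
  open import Algebra.Properties.Semiring.Exp semiring using (_^_; ^-congˡ; ^-assocʳ)
  open import Algebra.Properties.Semiring.Sum semiring
    using (sum; sum-init-last; sum-cong-≋; sum-replicate-zero)
  import Algebra.Properties.CommutativeSemiring.Binomial commutativeSemiring as Binomial
  open import Relation.Binary.Reasoning.Setoid setoid
  open PrimeArithmetic

  pow≈^ : ∀ x e → pow x e ≈ x ^ e
  pow≈^ x zero = refl
  pow≈^ x (suc e) = *-congˡ (pow≈^ x e)

  ×≈×1* : ∀ N z → N × z ≈ (N × 1#) * z
  ×≈×1* N z = begin
    N × z         ≈⟨ ×-congʳ N (*-identityˡ z) ⟨
    N × (1# * z)  ≈⟨ ×-assoc-* N 1# z ⟨
    (N × 1#) * z  ∎

  multiples-vanish : ∀ N → N × 1# ≈ 0# → ∀ M z → N ∣ M → M × z ≈ 0#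
  multiples-vanish N N·1≈0 .(k ℕ.* N) z (divides k ≡.refl) = begin
    (k ℕ.* N) × z                ≈⟨ ×≈×1* (k ℕ.* N) z ⟩
    ((k ℕ.* N) × 1#) * z         ≈⟨ *-congʳ (×1-homo-* k N) ⟩
    ((k × 1#) * (N × 1#)) * z    ≈⟨ *-congʳ (*-congˡ N·1≈0) ⟩
    ((k × 1#) * 0#) * z          ≈⟨ *-congʳ (zeroʳ _) ⟩
    0# * z                       ≈⟨ zeroˡ z ⟩
    0#                           ∎

  ×1-^ : ∀ N e → (N ℕ.^ e) × 1# ≈ (N × 1#) ^ e
  ×1-^ N zero = +-identityʳ 1#
  ×1-^ N (suc e) = trans (×1-homo-* N (N ℕ.^ e)) (*-congˡ (×1-^ N e))

  AdditivePower : ℕ → Set (c ⊔ ℓ)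
  AdditivePower e = ∀ x y → (x + y) ^ e ≈ x ^ e + y ^ e

  additive-1 : AdditivePower 1
  additive-1 x y = trans (*-identityʳ _) (sym (+-cong (*-identityʳ x) (*-identityʳ y)))

  additive-* : ∀ {a b} → AdditivePower a → AdditivePower b → AdditivePower (a ℕ.* b)
  additive-* {a} {b} add-a add-b x y = begin
    (x + y) ^ (a ℕ.* b)            ≈⟨ ^-assocʳ (x + y) a b ⟨
    ((x + y) ^ a) ^ b              ≈⟨ ^-congˡ b (add-a x y) ⟩
    (x ^ a + y ^ a) ^ b            ≈⟨ add-b (x ^ a) (y ^ a) ⟩
    (x ^ a) ^ b + (y ^ a) ^ b      ≈⟨ +-cong (^-assocʳ x a b) (^-assocʳ y a b) ⟩
    x ^ (a ℕ.* b) + y ^ (a ℕ.* b)  ∎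

  additive-^ : ∀ {a} → AdditivePower a → ∀ t → AdditivePower (a ℕ.^ t)
  additive-^ add-a zero = additive-1
  additive-^ {a} add-a (suc t) = additive-* {a} {a ℕ.^ t} add-a (additive-^ add-a t)

  additive-neg : ∀ e .{{_ : ℕ.NonZero e}} → AdditivePower e → ∀ x → (- x) ^ e ≈ - (x ^ e)
  additive-neg (suc e) add x = +-inverseʳ-unique (x ^ suc e) ((- x) ^ suc e) (begin
    x ^ suc e + (- x) ^ suc e  ≈⟨ add x (- x) ⟨
    (x - x) ^ suc e            ≈⟨ ^-congˡ (suc e) (-‿inverseʳ x) ⟩
    0# * 0# ^ e                ≈⟨ zeroˡ _ ⟩
    0#                         ∎)

  -- In characteristic p the p-th power map is additive ("freshman's dream"):
  -- all binomial coefficients except the outer two are divisible by p.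
  module Characteristic (p : ℕ) (pp : Prime p) (char : p × 1# ≈ 0#) where

    freshman : AdditivePower p
    freshman x y with prime⇒2+ pp
    ... | r , ≡.refl = begin
      (x + y) ^ p                                            ≈⟨ Binomial.theorem p x y ⟩
      term zero + sum (tail term)                            ≈⟨ +-congˡ (sum-init-last (tail term)) ⟩
      term zero + (sum (init (tail term)) + term (fromℕ p))  ≈⟨ +-cong first (+-cong middle last) ⟩
      y ^ p + (0# + x ^ p)                                   ≈⟨ +-congˡ (+-identityˡ _) ⟩
      y ^ p + x ^ p                                          ≈⟨ +-comm _ _ ⟩
      x ^ p + y ^ p                                          ∎
      where
        term : Fin (suc p) → Carrier
        term = Binomial.binomialTerm x y p
        first : term zero ≈ y ^ p
        first = trans (+-identityʳ _) (*-identityˡ _)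
        middle : sum (init (tail term)) ≈ 0#
        middle = trans
          (sum-cong-≋ λ i → multiples-vanish p char _ (Binomial.binomial x y p (suc (inject₁ i)))
                              (prime∣binomial pp z<s (s<s (inject₁ℕ< i))))
          (sum-replicate-zero (suc r))
        last : term (fromℕ p) ≈ x ^ p
        last = begin
          term (fromℕ p)
            ≡⟨ ≡.cong (λ k → (p C k) × (x ^ k * y ^ (p ℕ.∸ k))) (toℕ-fromℕ p) ⟩
          (p C p) × (x ^ p * y ^ (p ℕ.∸ p))
            ≡⟨ ≡.cong₂ (λ a b → a × (x ^ p * y ^ b)) (nCn≡1 p) (ℕ.n∸n≡0 p) ⟩
          1 × (x ^ p * 1#)  ≈⟨ +-identityʳ _ ⟩
          x ^ p * 1#        ≈⟨ *-identityʳ _ ⟩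
          x ^ p             ∎

    frobenius : ∀ t → AdditivePower (p ℕ.^ t)
    frobenius = additive-^ freshman

    frobenius-neg : ∀ t x → (- x) ^ (p ℕ.^ t) ≈ - (x ^ (p ℕ.^ t))
    frobenius-neg t = additive-neg (p ℕ.^ t) {{ℕ.m^n≢0 p t {{prime⇒nonZero pp}}}} (frobenius t)

  LabellingInjective : ℕ → Set (c ⊔ ℓ)
  LabellingInjective d = ∀ a b → pow a d + a ≈ pow b d + b → a ≈ b

module FieldFacts {c ℓ : Level} (R : CommutativeRing c ℓ) (isField : FF.IsField R) where
  open CommutativeRing R hiding (zero)
  open import Algebra.Properties.Semiring.Exp semiring using (_^_)

  0≉1 : ¬ (0# ≈ 1#)
  0≉1 = proj₁ isField

  *-cancelˡ-nonzero : ∀ {a x y} → ¬ (a ≈ 0#) → a * x ≈ a * y → x ≈ y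
  *-cancelˡ-nonzero {a} {x} {y} a≉0 ax≈ay with proj₂ isField a a≉0
  ... | b , ab≈1 = trans (sym (undo x)) (trans (*-congˡ ax≈ay) (undo y))
    where
      undo : ∀ z → b * (a * z) ≈ z
      undo z = trans (sym (*-assoc b a z))
                     (trans (*-congʳ (trans (*-comm b a) ab≈1)) (*-identityˡ z))

  *-nonzero : ∀ {x y} → ¬ (x ≈ 0#) → ¬ (y ≈ 0#) → ¬ (x * y ≈ 0#)
  *-nonzero {x} x≉0 y≉0 xy≈0 = y≉0 (*-cancelˡ-nonzero x≉0 (trans xy≈0 (sym (zeroʳ x))))

  ^-nonzero : ∀ {x} → ¬ (x ≈ 0#) → ∀ e → ¬ (x ^ e ≈ 0#)
  ^-nonzero x≉0 zero 1≈0 = 0≉1 (sym 1≈0)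
  ^-nonzero x≉0 (suc e) = *-nonzero x≉0 (^-nonzero x≉0 e)

module EnumeratedSums {c ℓ : Level} (M : CommutativeMonoid c ℓ) (m : ℕ)
    (enum : Inverse (≡.setoid (Fin m)) (CommutativeMonoid.setoid M)) where
  open CommutativeMonoid M
  open import Algebra.Properties.CommutativeMonoid.Sum M public
  open import Relation.Binary.Reasoning.Setoid setoid
  open Inverse enum using (to; from; strictlyInverseˡ; inverseʳ)

  total : (Carrier → Carrier) → Carrier
  total F = sum (λ i → F (to i))

  total-reindex : (F σ τ : Carrier → Carrier) →
    Congruent _≈_ _≈_ F → Congruent _≈_ _≈_ σ → Congruent _≈_ _≈_ τ →
    (∀ x → σ (τ x) ≈ x) → (∀ x → τ (σ x) ≈ x) →
    total (λ x → F (σ x)) ≈ total F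
  total-reindex F σ τ F-cong σ-cong τ-cong στ τσ = sym (begin
    total F                               ≈⟨ sum-permute (λ i → F (to i)) π ⟩
    sum (λ i → F (to (from (σ (to i)))))
      ≈⟨ sum-cong-≋ (λ i → F-cong (strictlyInverseˡ (σ (to i)))) ⟩
    total (λ x → F (σ x))                 ∎)
    where
      π : Permutation′ m
      π = permutation (λ i → from (σ (to i))) (λ i → from (τ (to i)))
            (λ i → inverseʳ (trans (σ-cong (strictlyInverseˡ _)) (στ (to i))))
            (λ i → inverseʳ (trans (τ-cong (strictlyInverseˡ _)) (τσ (to i))))

  sum-single : ∀ {n} (h : Fin n → Carrier) j →
    (∀ i → ¬ (i ≡.≡ j) → h i ≈ ε) → sum h ≈ h j
  sum-single {suc n} h j others = begin
    sum h                       ≈⟨ sum-remove {i = j} h ⟩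
    h j ∙ sum (removeAt h j)
      ≈⟨ ∙-congˡ (sum-cong-≋ (λ i → others (punchIn j i) (punchInᵢ≢i j i))) ⟩
    h j ∙ sum {n} (λ _ → ε)     ≈⟨ ∙-congˡ (sum-replicate-zero n) ⟩
    h j ∙ ε                     ≈⟨ identityʳ (h j) ⟩
    h j                         ∎

module FiniteField {c ℓ : Level} (R : CommutativeRing c ℓ) (isField : FF.IsField R) (m : ℕ)
    (order : FF.HasOrder R m) where
  open CommutativeRing R hiding (zero)
  open FieldFacts R isField
  open PowerMaps R using (×1-^)
  open import Algebra.Properties.Ring ring using (+-cancelˡ)
  open import Algebra.Properties.Semiring.Mult semiring using (_×_)
  open import Algebra.Properties.Semiring.Exp semiring using (_^_)
  open import Relation.Binary.Reasoning.Setoid setoid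
  open Inverse order using (to; from; from-cong; strictlyInverseˡ; inverseʳ)
  module Σ = EnumeratedSums +-commutativeMonoid m order
  module Π = EnumeratedSums *-commutativeMonoid m order

  _≟_ : ∀ x y → Dec (x ≈ y)
  x ≟ y with from x Data.Fin.≟ from y
  ... | yes i≡j = yes (trans (sym (strictlyInverseˡ x))
                        (trans (reflexive (≡.cong to i≡j)) (strictlyInverseˡ y)))
  ... | no i≢j = no (λ x≈y → i≢j (from-cong x≈y))

  -- m · 1 = 0, because x ↦ x + 1 permutes R and so leaves ∑_x x unchanged.
  order·1≈0 : m × 1# ≈ 0#
  order·1≈0 = +-cancelˡ S (m × 1#) 0# (begin
    S + m × 1#                      ≈⟨ +-congˡ (Σ.sum-replicate m) ⟨
    S + Σ.sum {m} (λ _ → 1#)        ≈⟨ Σ.∑-distrib-+ to (λ _ → 1#) ⟨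
    Σ.total (λ x → x + 1#)
      ≈⟨ Σ.total-reindex id (_+ 1#) (_- 1#) id +-congʳ +-congʳ
           (λ x → shift x (- 1#) 1# (-‿inverseˡ 1#)) (λ x → shift x 1# (- 1#) (-‿inverseʳ 1#)) ⟩
    S                               ≈⟨ +-identityʳ S ⟨
    S + 0#                          ∎)
    where
      S : Carrier
      S = Σ.total (λ x → x)
      shift : ∀ x a b → a + b ≈ 0# → (x + a) + b ≈ x
      shift x a b a+b≈0 = trans (+-assoc x a b) (trans (+-congˡ a+b≈0) (+-identityʳ x))

  no-nilpotents : ∀ z e → z ^ e ≈ 0# → z ≈ 0#
  no-nilpotents z e zᵉ≈0 with z ≟ 0#
  ... | yes z≈0 = z≈0
  ... | no z≉0 = ⊥-elim (^-nonzero z≉0 e zᵉ≈0)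

  characteristic : ∀ p e → m ≡.≡ p ℕ.^ e → p × 1# ≈ 0#
  characteristic p e ≡.refl = no-nilpotents (p × 1#) e (trans (sym (×1-^ p e)) order·1≈0)

  -- For a ≠ 0 compare the products
  -- ∏_x a · unit x and ∏_x unit (a x), where unit replaces 0 by 1: they differ
  -- only in the factor at x = 0, and x ↦ a x permutes R.
  unit : Carrier → Carrier
  unit x with x ≟ 0#
  ... | yes _ = 1#
  ... | no _ = x

  unit-cong : Congruent _≈_ _≈_ unit
  unit-cong {x} {y} x≈y with x ≟ 0# | y ≟ 0#
  ... | yes _ | yes _ = refl
  ... | yes x≈0 | no y≉0 = ⊥-elim (y≉0 (trans (sym x≈y) x≈0))
  ... | no x≉0 | yes y≈0 = ⊥-elim (x≉0 (trans x≈y y≈0))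
  ... | no _ | no _ = x≈y

  unit-nonzero : ∀ x → ¬ (unit x ≈ 0#)
  unit-nonzero x with x ≟ 0#
  ... | yes _ = λ 1≈0 → 0≉1 (sym 1≈0)
  ... | no x≉0 = x≉0

  -- The factor by which a · unit x and unit (a x) differ.
  defect : Carrier → Carrier → Carrier
  defect a x with x ≟ 0#
  ... | yes _ = a
  ... | no _ = 1#

  unit-scale : ∀ a → ¬ (a ≈ 0#) → ∀ x → a * unit x ≈ unit (a * x) * defect a x
  unit-scale a a≉0 x with x ≟ 0# | (a * x) ≟ 0#
  ... | yes _ | yes _ = *-comm a 1#
  ... | yes x≈0 | no ax≉0 = ⊥-elim (ax≉0 (trans (*-congˡ x≈0) (zeroʳ a)))
  ... | no x≉0 | yes ax≈0 = ⊥-elim (*-nonzero a≉0 x≉0 ax≈0)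
  ... | no _ | no _ = sym (*-identityʳ (a * x))

  total-defect : ∀ a → Π.total (defect a) ≈ a
  total-defect a = trans (Π.sum-single (λ i → defect a (to i)) (from 0#) others) at-zero
    where
      at-zero : defect a (to (from 0#)) ≈ a
      at-zero with to (from 0#) ≟ 0#
      ... | yes _ = refl
      ... | no to-from-0≉0 = ⊥-elim (to-from-0≉0 (strictlyInverseˡ 0#))
      others : ∀ i → ¬ (i ≡.≡ from 0#) → defect a (to i) ≈ 1#
      others i i≢from0 with to i ≟ 0#
      ... | yes to-i≈0 = ⊥-elim (i≢from0 (≡.sym (inverseʳ (sym to-i≈0))))
      ... | no _ = refl

  product-nonzero : ∀ {n} (h : Fin n → Carrier) → (∀ i → ¬ (h i ≈ 0#)) → ¬ (Π.sum h ≈ 0#)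
  product-nonzero {zero} h _ 1≈0 = 0≉1 (sym 1≈0)
  product-nonzero {suc n} h h≉0 =
    *-nonzero (h≉0 zero) (product-nonzero (λ i → h (suc i)) (λ i → h≉0 (suc i)))

  fermat-nonzero : ∀ a → ¬ (a ≈ 0#) → a ^ m ≈ a
  fermat-nonzero a a≉0 with proj₂ isField a a≉0
  ... | b , ab≈1 = *-cancelˡ-nonzero P≉0 (begin
    P * a ^ m                                  ≈⟨ *-comm P (a ^ m) ⟩
    a ^ m * P                                  ≈⟨ *-congʳ (Π.sum-replicate m) ⟨
    Π.sum {m} (λ _ → a) * P                    ≈⟨ Π.∑-distrib-+ (λ _ → a) (λ i → unit (to i)) ⟨
    Π.total (λ x → a * unit x)                 ≈⟨ Π.sum-cong-≋ (λ i → unit-scale a a≉0 (to i)) ⟩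
    Π.total (λ x → unit (a * x) * defect a x)
      ≈⟨ Π.∑-distrib-+ (λ i → unit (a * to i)) (λ i → defect a (to i)) ⟩
    Π.total (λ x → unit (a * x)) * Π.total (defect a)
      ≈⟨ *-cong (Π.total-reindex unit (a *_) (b *_) unit-cong *-congˡ *-congˡ
                  (undo a b ab≈1) (undo b a ba≈1))
                (total-defect a) ⟩
    P * a                                      ∎)
    where
      P : Carrier
      P = Π.total unit
      P≉0 : ¬ (P ≈ 0#)
      P≉0 = product-nonzero (λ i → unit (to i)) (λ i → unit-nonzero (to i))
      ba≈1 : b * a ≈ 1#
      ba≈1 = trans (*-comm b a) ab≈1
      undo : ∀ u v → u * v ≈ 1# → ∀ x → u * (v * x) ≈ x
      undo u v uv≈1 x = trans (sym (*-assoc u v x)) (trans (*-congʳ uv≈1) (*-identityˡ x))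

  fermat : ∀ a → a ^ m ≈ a
  fermat a with a ≟ 0#
  ... | no a≉0 = fermat-nonzero a a≉0
  ... | yes a≈0 = positive-power (from a)
    where
      -- m is positive, since a ∈ R is enumerated by an element of Fin m.
      positive-power : ∀ {k} → Fin k → a ^ k ≈ a
      positive-power {suc k} _ = trans (*-congʳ a≈0) (trans (zeroˡ _) (sym a≈0))

module FixedField {c ℓ : Level} (R : CommutativeRing c ℓ) (isField : FF.IsField R)
    (q : ℕ) .{{_ : ℕ.NonZero q}} (additive : PowerMaps.AdditivePower R q) where
  open CommutativeRing R hiding (zero)
  open FF R using (InSub)
  open FieldFacts R isField
  open PowerMaps R using (pow≈^; additive-neg)
  open import Algebra.Properties.Semiring.Exp semiring using (_^_; ^-congˡ; ^-assocʳ)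
  open import Algebra.Properties.CommutativeSemiring.Exp commutativeSemiring using (^-distrib-*)
  open import Relation.Binary.Reasoning.Setoid setoid

  Fixed : Carrier → Set ℓ
  Fixed x = x ^ q ≈ x

  InSub⇒Fixed : ∀ {x} → InSub q x → Fixed x
  InSub⇒Fixed {x} = trans (sym (pow≈^ x q))

  Fixed⇒InSub : ∀ {x} → Fixed x → InSub q x
  Fixed⇒InSub {x} = trans (pow≈^ x q)

  fixed-cong : ∀ {x y} → x ≈ y → Fixed x → Fixed y
  fixed-cong x≈y x∈F = trans (^-congˡ q (sym x≈y)) (trans x∈F x≈y)

  fixed-+ : ∀ {x y} → Fixed x → Fixed y → Fixed (x + y)
  fixed-+ {x} {y} x∈F y∈F = trans (additive x y) (+-cong x∈F y∈F)

  fixed-neg : ∀ {x} → Fixed x → Fixed (- x)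
  fixed-neg {x} x∈F = trans (additive-neg q additive x) (-‿cong x∈F)

  fixed-* : ∀ {x y} → Fixed x → Fixed y → Fixed (x * y)
  fixed-* {x} {y} x∈F y∈F = trans (^-distrib-* x y q) (*-cong x∈F y∈F)

  fixed-^ : ∀ {x} e → Fixed x → Fixed (x ^ e)
  fixed-^ {x} e x∈F = begin
    (x ^ e) ^ q    ≈⟨ ^-assocʳ x e q ⟩
    x ^ (e ℕ.* q)  ≡⟨ ≡.cong (x ^_) (ℕ.*-comm e q) ⟩
    x ^ (q ℕ.* e)  ≈⟨ ^-assocʳ x q e ⟨
    (x ^ q) ^ e    ≈⟨ ^-congˡ e x∈F ⟩
    x ^ e          ∎

  fixed-cancel : ∀ {t x} → Fixed t → ¬ (t ≈ 0#) → Fixed (t * x) → Fixed x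
  fixed-cancel {t} {x} t∈F t≉0 tx∈F = *-cancelˡ-nonzero t≉0 (begin
    t * x ^ q      ≈⟨ *-congʳ t∈F ⟨
    t ^ q * x ^ q  ≈⟨ ^-distrib-* t x q ⟨
    (t * x) ^ q    ≈⟨ tx∈F ⟩
    t * x          ∎)

module Independence {c ℓ : Level} (R : CommutativeRing c ℓ) (isField : FF.IsField R)
    (q : ℕ) .{{_ : ℕ.NonZero q}} (additive : PowerMaps.AdditivePower R q)
    (d : ℕ) (injective : PowerMaps.LabellingInjective R d) where
  open CommutativeRing R hiding (zero)
  open FF R using (InSub; IndependentSet; ISet; pow)
  open PowerMaps R using (pow≈^)
  open FixedField R isField q additive
  open import Algebra.Properties.Ring ring using (+-inverseʳ-unique; x≈z//y)
  open import Relation.Binary.Reasoning.Setoid setoid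
  open import Tactic.RingSolver.Core.AlmostCommutativeRing using (fromCommutativeRing)
  open import Tactic.RingSolver.NonReflective (fromCommutativeRing R (λ _ → nothing))
    using (solve; _⊕_; _⊗_; _⊜_)

  edge-value-fixed : ∀ {a b} → Fixed a → Fixed b → Fixed (pow a d * b + a * pow b d)
  edge-value-fixed {a} {b} a∈F b∈F =
    fixed-+ (fixed-* (pow-fixed a∈F) b∈F) (fixed-* a∈F (pow-fixed b∈F))
    where
      pow-fixed : ∀ {x} → Fixed x → Fixed (pow x d)
      pow-fixed {x} x∈F = fixed-cong (sym (pow≈^ x d)) (fixed-^ d x∈F)

  split-μ : ∀ x₁ x₂ y₁ y₂ μ → (x₂ + y₂) * μ + (x₁ + y₁) ≈ (x₁ + x₂ * μ) + (y₁ + y₂ * μ)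
  split-μ = solve 5 (λ x₁ x₂ y₁ y₂ μ →
    (((x₂ ⊕ y₂) ⊗ μ) ⊕ (x₁ ⊕ y₁)) ⊜ ((x₁ ⊕ (x₂ ⊗ μ)) ⊕ (y₁ ⊕ (y₂ ⊗ μ)))) refl

  independent : ∀ μ → ¬ InSub q μ → (S : Carrier → Set ℓ) →
    (∀ a b → a ≈ b → S a → S b) → (∀ a → S a → Fixed a) → (∀ a → ¬ (S a ∧ S (- a))) →
    IndependentSet d (ISet q d μ S)
  independent μ μ∉F S S-cong S⊆F S-disjoint (u₁ , u₂) (v₁ , v₂)
    (A , x₁ , x₂ , A∈F , x₁∈F , x₂∈S , u₁≈A , u₂≈x)
    (B , y₁ , y₂ , B∈F , y₁∈F , y₂∈S , v₁≈B , v₂≈y)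
    (_ , a , b , x , y , (u₁≈a , u₂≈x′) , (v₁≈b , v₂≈y′) , edge) =
    μ∉F (Fixed⇒InSub (fixed-cancel t∈F t≉0 tμ∈F))
    where
      t : Carrier
      t = x₂ + y₂
      t∈F : Fixed t
      t∈F = fixed-+ (S⊆F x₂ x₂∈S) (S⊆F y₂ y₂∈S)
      -- t = 0 would put both x₂ and -x₂ into S.
      t≉0 : ¬ (t ≈ 0#)
      t≉0 t≈0 = S-disjoint x₂ (x₂∈S , S-cong y₂ (- x₂) (+-inverseʳ-unique x₂ y₂ t≈0) y₂∈S)
      -- the edge endpoints carry the labels of A and B
      a∈F : Fixed a
      a∈F = fixed-cong (sym (injective a A (trans (sym u₁≈a) u₁≈A))) (InSub⇒Fixed A∈F)
      b∈F : Fixed b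
      b∈F = fixed-cong (sym (injective b B (trans (sym v₁≈b) v₁≈B))) (InSub⇒Fixed B∈F)
      tμ∈F : Fixed (t * μ)
      tμ∈F = fixed-cong
        (sym (x≈z//y (t * μ) (x₁ + y₁) _ (begin
          t * μ + (x₁ + y₁)                  ≈⟨ split-μ x₁ x₂ y₁ y₂ μ ⟩
          (x₁ + x₂ * μ) + (y₁ + y₂ * μ)
            ≈⟨ +-cong (trans (sym u₂≈x) u₂≈x′) (trans (sym v₂≈y) v₂≈y′) ⟩
          x + y                              ≈⟨ edge ⟨
          pow a d * b + a * pow b d          ∎)))
        (fixed-+ (edge-value-fixed a∈F b∈F)
                 (fixed-neg (fixed-+ (InSub⇒Fixed x₁∈F) (InSub⇒Fixed y₁∈F))))

-- In the field of order p^(2n), p odd, the labelling a ↦ a^d + a with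
-- d = p^s is injective when k = 2n/s is odd: a nonzero c with c^d = -c would
-- satisfy c = c^(p^(2n)) = c^(d^k) = -c, i.e. 2c = 0.
module OddQuotientLabelling {c ℓ : Level} (R : CommutativeRing c ℓ) (isField : FF.IsField R)
    (p n s k : ℕ) (pp : Prime p) (p≢2 : ¬ (p ≡.≡ 2)) (2n≡ks : 2 ℕ.* n ≡.≡ k ℕ.* s)
    (odd-k : OddNat k) (order : FF.HasOrder R (p ℕ.^ (2 ℕ.* n))) where
  open CommutativeRing R hiding (zero)
  open FieldFacts R isField
  open FiniteField R isField (p ℕ.^ (2 ℕ.* n)) order using (fermat; characteristic)
  open PowerMaps R
  open import Algebra.Properties.Ring ring
    using (-‿involutive; +-inverseˡ-unique; x∙y⁻¹≈ε⇒x≈y; x≈y⇒x∙y⁻¹≈ε)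
  open import Algebra.Properties.Semiring.Mult semiring using (_×_)
  open import Algebra.Properties.Semiring.Exp semiring using (_^_; ^-congˡ; ^-assocʳ)
  open import Relation.Binary.Reasoning.Setoid setoid
  open import Tactic.RingSolver.Core.AlmostCommutativeRing using (fromCommutativeRing)
  open import Tactic.RingSolver.NonReflective (fromCommutativeRing R (λ _ → nothing))
    using (solve; _⊕_; _⊜_; ⊝_)

  char : p × 1# ≈ 0#
  char = characteristic p (2 ℕ.* n) ≡.refl

  open Characteristic p pp char using (frobenius; frobenius-neg)

  d : ℕ
  d = p ℕ.^ s

  instance
    p≢0 : ℕ.NonZero p
    p≢0 = prime⇒nonZero pp
    d≢0 : ℕ.NonZero d
    d≢0 = ℕ.m^n≢0 p s

  d^k≡order : d ℕ.^ k ≡.≡ p ℕ.^ (2 ℕ.* n)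
  d^k≡order = ≡.trans (ℕ.^-*-assoc p s k) (≡.cong (p ℕ.^_) (≡.trans (ℕ.*-comm s k) (≡.sym 2n≡ks)))

  -- 2 ≠ 0, since p = 1 + 2j is odd: otherwise p · 1 = 1 + (2j) · 1 = 1.
  two≉0 : ¬ (1# + 1# ≈ 0#)
  two≉0 2≈0 with PrimeArithmetic.odd-prime pp p≢2
  ... | j , p≡1+2j = 0≉1 (begin
    0#                      ≈⟨ char ⟨
    p × 1#                  ≡⟨ ≡.cong (_× 1#) p≡1+2j ⟩
    1# + (2 ℕ.* j) × 1#
      ≈⟨ +-congˡ (multiples-vanish 2 2·1≈0 (2 ℕ.* j) 1# (divides j (ℕ.*-comm 2 j))) ⟩
    1# + 0#                 ≈⟨ +-identityʳ 1# ⟩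
    1#                      ∎)
    where
      2·1≈0 : 2 × 1# ≈ 0#
      2·1≈0 = trans (+-congˡ (+-identityʳ 1#)) 2≈0

  neg-d^ : ∀ e x → (- x) ^ (d ℕ.^ e) ≈ - (x ^ (d ℕ.^ e))
  neg-d^ e = additive-neg (d ℕ.^ e) {{ℕ.m^n≢0 d e}} (additive-^ (frobenius s) e)

  module _ {x : Carrier} (xᵈ≈-x : x ^ d ≈ - x) where

    sign-step : ∀ e → x ^ (d ℕ.^ suc e) ≈ - (x ^ (d ℕ.^ e))
    sign-step e = begin
      x ^ (d ℕ.* d ℕ.^ e)    ≈⟨ ^-assocʳ x d (d ℕ.^ e) ⟨
      (x ^ d) ^ (d ℕ.^ e)    ≈⟨ ^-congˡ (d ℕ.^ e) xᵈ≈-x ⟩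
      (- x) ^ (d ℕ.^ e)      ≈⟨ neg-d^ e x ⟩
      - (x ^ (d ℕ.^ e))      ∎

    odd-iterate : ∀ j → x ^ (d ℕ.^ suc (2 ℕ.* j)) ≈ - x
    odd-iterate zero = trans (sign-step 0) (-‿cong (*-identityʳ x))
    odd-iterate (suc j) = begin
      x ^ (d ℕ.^ suc (2 ℕ.* suc j))            ≡⟨ ≡.cong (λ e → x ^ (d ℕ.^ suc e)) (ℕ.*-suc 2 j) ⟩
      x ^ (d ℕ.^ suc (suc (suc (2 ℕ.* j))))    ≈⟨ sign-step (suc (suc (2 ℕ.* j))) ⟩
      - (x ^ (d ℕ.^ suc (suc (2 ℕ.* j))))      ≈⟨ -‿cong (sign-step (suc (2 ℕ.* j))) ⟩
      - - (x ^ (d ℕ.^ suc (2 ℕ.* j)))          ≈⟨ -‿involutive _ ⟩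
      x ^ (d ℕ.^ suc (2 ℕ.* j))                ≈⟨ odd-iterate j ⟩
      - x                                       ∎

    -- Hence x = -x by Fermat, and x = 0 because 2 ≠ 0.
    anti-fixed⇒0 : x ≈ 0#
    anti-fixed⇒0 = *-cancelˡ-nonzero two≉0 (begin
      (1# + 1#) * x    ≈⟨ distribʳ x 1# 1# ⟩
      1# * x + 1# * x  ≈⟨ +-cong (*-identityˡ x) (*-identityˡ x) ⟩
      x + x            ≈⟨ +-congˡ x≈-x ⟩
      x - x            ≈⟨ -‿inverseʳ x ⟩
      0#               ≈⟨ zeroʳ _ ⟨
      (1# + 1#) * 0#   ∎)
      where
        x≈-x : x ≈ - x
        x≈-x = begin
          x                                ≈⟨ fermat x ⟨
          x ^ (p ℕ.^ (2 ℕ.* n))            ≡⟨ ≡.cong (x ^_) d^k≡order ⟨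
          x ^ (d ℕ.^ k)                    ≡⟨ ≡.cong (λ e → x ^ (d ℕ.^ e)) (proj₂ odd-k) ⟩
          x ^ (d ℕ.^ suc (2 ℕ.* j))        ≈⟨ odd-iterate j ⟩
          - x                              ∎
          where
            j : ℕ
            j = proj₁ odd-k

  -- Equal labels a^d + a = b^d + b make a - b a root of c^d = -c, by additivity.
  labelling-injective : LabellingInjective d
  labelling-injective a b labels≈ = x∙y⁻¹≈ε⇒x≈y a b (anti-fixed⇒0 (begin
    (a - b) ^ d           ≈⟨ frobenius s a (- b) ⟩
    a ^ d + (- b) ^ d     ≈⟨ +-congˡ (frobenius-neg s b) ⟩
    a ^ d - b ^ d         ≈⟨ +-inverseˡ-unique (a ^ d - b ^ d) (a - b) differences-cancel ⟩
    - (a - b)             ∎))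
    where
      regroup : ∀ A B a b → (A - B) + (a - b) ≈ (A + a) - (B + b)
      regroup = solve 4 (λ A B a b →
        ((A ⊕ (⊝ B)) ⊕ (a ⊕ (⊝ b))) ⊜ ((A ⊕ a) ⊕ (⊝ (B ⊕ b)))) refl
      labels≈′ : a ^ d + a ≈ b ^ d + b
      labels≈′ = trans (+-congʳ (sym (pow≈^ a d))) (trans labels≈ (+-congʳ (pow≈^ b d)))
      differences-cancel : (a ^ d - b ^ d) + (a - b) ≈ 0#
      differences-cancel = trans (regroup (a ^ d) (b ^ d) a b) (x≈y⇒x∙y⁻¹≈ε labels≈′)

open import Data.Nat using (_+_; _*_; _^_; _≤_; _∸_)
open import Data.Product using (_×_)
open import Relation.Binary.PropositionalEquality using (_≡_)

mainTheorem9 : {c ℓ : Level} (R : CommutativeRing c ℓ) →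
    FF.IsField R →
    (p n s : ℕ) → Prime p → ¬ (p ≡ 2) → 1 ≤ n → 1 ≤ s →
    (k : ℕ) → 2 * n ≡ k * s → 3 ≤ k → OddNat k →
    FF.HasOrder R (p ^ (2 * n)) →
    (μ u₁ u₂ : CommutativeRing.Carrier R) →
    ¬ FF.InSub R (p ^ n) μ →
    FF.InSub R (p ^ n) u₁ → FF.InSub R (p ^ n) u₂ →
    CommutativeRing._≈_ R (FF.pow R μ (p ^ s))
      (CommutativeRing._+_ R u₁ (CommutativeRing._*_ R u₂ μ)) →
    (∃ λ w → CommutativeRing._≈_ R (FF.pow R w (p ^ s ∸ 1)) u₂) →
    (Plus : CommutativeRing.Carrier R → Set ℓ) →
    FF.SignPartition R (p ^ n) Plus →
    FF.IndependentSet R (p ^ s) (FF.ISet R (p ^ n) (p ^ s) μ Plus) ×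
    FF.IndependentSet R (p ^ s)
      (FF.ISet R (p ^ n) (p ^ s) μ (λ a → Plus (CommutativeRing.-_ R a)))
mainTheorem9 {ℓ = ℓ} R isField p n s pp p≢2 _ _ k 2n≡ks _ odd-k order μ _ _ μ∉F _ _ _ _
  Plus (Plus-cong , Plus⊆F , _ , Plus-disjoint) =
    independent μ μ∉F Plus Plus-cong Plus⊆Fixed Plus-disjoint ,
    independent μ μ∉F Minus Minus-cong Minus⊆Fixed (λ a → Plus-disjoint (- a))
  where
    open CommutativeRing R using (Carrier; _≈_; -_; -‿cong)
    open import Algebra.Properties.Ring (CommutativeRing.ring R) using (-‿involutive)
    open OddQuotientLabelling R isField p n s k pp p≢2 2n≡ks odd-k order
      using (char; labelling-injective)
    open PowerMaps.Characteristic R p pp char using (frobenius)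
    instance
      q≢0 : ℕ.NonZero (p ^ n)
      q≢0 = ℕ.m^n≢0 p n {{prime⇒nonZero pp}}
    open FixedField R isField (p ^ n) (frobenius n) using (Fixed; InSub⇒Fixed; fixed-cong; fixed-neg)
    open Independence R isField (p ^ n) (frobenius n) (p ^ s) labelling-injective using (independent)

    Plus⊆Fixed : ∀ a → Plus a → Fixed a
    Plus⊆Fixed a a∈Plus = InSub⇒Fixed (proj₁ (Plus⊆F a a∈Plus))

    Minus : Carrier → Set ℓ
    Minus a = Plus (- a)

    Minus-cong : ∀ a b → a ≈ b → Minus a → Minus b
    Minus-cong a b a≈b = Plus-cong (- a) (- b) (-‿cong a≈b)

    Minus⊆Fixed : ∀ a → Minus a → Fixed a
    Minus⊆Fixed a -a∈Plus = fixed-cong (-‿involutive a) (fixed-neg (Plus⊆Fixed (- a) -a∈Plus))
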